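{- Assume the setting below. Then the maps $\omega_X:Q(X)\to Q(X^{*})^{op}$ are the components of a natural transformation between functors $\mathsf{C}\to\mathsf{SLatt}$, from $Q$ to the functor $X\mapsto Q(X^{*})^{op}$, $f\mapsto Q(f^{*})^{op}$. In particular, for every $f:X\to Y$, $\omega_Y\circ Q(f)=Q(f^{*})^{op}\circ\omega_X$.
   Context: $(\mathsf{C},\otimes,I,a,\lambda,\rho,\sigma)$ is symmetric monoidal closed with internal hom $\multimap$ and counit $\mathrm{ev}_{X,Y}:X\otimes(X\multimap Y)\to Y$. $Q:\mathsf{C}\to\mathsf{Pos}$ monoidally factors through $\mathsf{SLatt}$: each $Q(X)$ is a complete lattice, each $Q(f)$ preserves all suprema, and there are $u\in Q(I)$ and maps $\mu_{X,Y}:Q(X)\times Q(Y)\to Q(X\otimes Y)$ that are natural, sup-preserving in each variable, and satisfy $Q(\lambda_Y)(\mu_{I,Y}(u,y))=y$, $Q(\rho_X)(\mu_{X,I}(x,u))=x$, $Q(a)(\mu(\mu(x,y),z))=\mu(x,\mu(y,z))$, $Q(\sigma_{X,Y})(\mu_{X,Y}(x,y))=\mu_{Y,X}(y,x)$. Put $\langle x,b\rangle_{X,Y}:=Q(\mathrm{ev}_{X,Y})(\mu_{X,X\multimap Y}(x,b))$; it preserves suprema in $b$, and $\iota_{X,Y}(\alpha,-)$ denotes its right adjoint. Fix an object $0$ and $\omega\in Q(0)$; let $X^{*}:=X\multimap 0$ (a contravariant functor, $f^*:=f\multimap 0$) and $\omega_X(\alpha):=\iota_{X,0}(\alpha,\omega)$.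 $(-)^{op}:\mathsf{SLatt}^{op}\to\mathsf{SLatt}$ sends a complete lattice to its opposite and a sup-preserving map to its right adjoint; thus $Q(f^{*})^{op}:Q(X^{*})^{op}\to Q(Y^{*})^{op}$ is the right adjoint of $Q(f^{*}):Q(Y^{*})\to Q(X^{*})$. -}

module Defs where

open import Level using (Level; _⊔_) renaming (suc to lsuc)
open import Relation.Binary.PropositionalEquality using (_≡_)
open import Relation.Binary.Structures using (IsPartialOrder)
open import Relation.Unary using (Pred)
open import Data.Product using (_×_; ∃)

record CompleteLattice (ℓ : Level) : Set (lsuc ℓ) where
  infix 4 _≤_
  field
    Carrier        : Set ℓ
    _≤_            : Carrier → Carrier → Set ℓ
    isPartialOrder : IsPartialOrder _≡_ _≤_
    ⋁              : Pred Carrier ℓ → Carrier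
    ⋁-upper        : ∀ (S : Pred Carrier ℓ) x → S x → x ≤ ⋁ S
    ⋁-least        : ∀ (S : Pred Carrier ℓ) y → (∀ x → S x → x ≤ y) → ⋁ S ≤ y

  ⋀ : Pred Carrier ℓ → Carrier
  ⋀ S = ⋁ (λ y → ∀ x → S x → y ≤ x)

open CompleteLattice public using (Carrier)

Image : ∀ {ℓ} {A B : Set ℓ} → (A → B) → Pred A ℓ → Pred B ℓ
Image {A = A} f S b = ∃ λ (a : A) → S a × b ≡ f a

-- right adjoint of a map g : L → M between complete lattices,
-- r(m) = ⋁ { l | g l ≤ m }.  For sup-preserving g this is (g)^op.
rightAdjoint : ∀ {ℓ} (L M : CompleteLattice ℓ) →
               (Carrier L → Carrier M) → Carrier M → Carrier L
rightAdjoint L M g m = CompleteLattice.⋁ L (λ l → CompleteLattice._≤_ M (g l) m)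

record Category (o h : Level) : Set (lsuc (o ⊔ h)) where
  infixr 9 _∘_
  field
    Obj       : Set o
    Hom       : Obj → Obj → Set h
    id        : ∀ {A} → Hom A A
    _∘_       : ∀ {A B C} → Hom B C → Hom A B → Hom A C
    identityˡ : ∀ {A B} (f : Hom A B) → id ∘ f ≡ f
    identityʳ : ∀ {A B} (f : Hom A B) → f ∘ id ≡ f
    assoc     : ∀ {A B C D} (f : Hom A B) (g : Hom B C) (k : Hom C D) →
                (k ∘ g) ∘ f ≡ k ∘ (g ∘ f)

module _ {o h} (C : Category o h) where
  open Category C

  record SymMonClosed : Set (o ⊔ h) where
    infixr 10 _⊗₀_ _⊗₁_
    infixr 5 _⊸_
    field
      _⊗₀_   : Obj → Obj → Obj
      _⊗₁_   : ∀ {A B C D} → Hom A B → Hom C D → Hom (A ⊗₀ C) (B ⊗₀ D)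
      ⊗-id   : ∀ {A B} → id {A} ⊗₁ id {B} ≡ id
      ⊗-∘    : ∀ {A B C D E F} (f : Hom A B) (g : Hom B C) (k : Hom D E) (l : Hom E F) →
               (g ∘ f) ⊗₁ (l ∘ k) ≡ (g ⊗₁ l) ∘ (f ⊗₁ k)
      I      : Obj
      a⇒     : ∀ {A B C} → Hom ((A ⊗₀ B) ⊗₀ C) (A ⊗₀ (B ⊗₀ C))
      a⇐     : ∀ {A B C} → Hom (A ⊗₀ (B ⊗₀ C)) ((A ⊗₀ B) ⊗₀ C)
      a-isoˡ : ∀ {A B C} → a⇐ {A} {B} {C} ∘ a⇒ ≡ id
      a-isoʳ : ∀ {A B C} → a⇒ {A} {B} {C} ∘ a⇐ ≡ id
      a-nat  : ∀ {A B C D E F} (f : Hom A D) (g : Hom B E) (k : Hom C F) →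
               a⇒ ∘ ((f ⊗₁ g) ⊗₁ k) ≡ (f ⊗₁ (g ⊗₁ k)) ∘ a⇒
      l⇒     : ∀ {A} → Hom (I ⊗₀ A) A
      l⇐     : ∀ {A} → Hom A (I ⊗₀ A)
      l-isoˡ : ∀ {A} → l⇐ {A} ∘ l⇒ ≡ id
      l-isoʳ : ∀ {A} → l⇒ {A} ∘ l⇐ ≡ id
      l-nat  : ∀ {A B} (f : Hom A B) → l⇒ ∘ (id {I} ⊗₁ f) ≡ f ∘ l⇒
      r⇒     : ∀ {A} → Hom (A ⊗₀ I) A
      r⇐     : ∀ {A} → Hom A (A ⊗₀ I)
      r-isoˡ : ∀ {A} → r⇐ {A} ∘ r⇒ ≡ id
      r-isoʳ : ∀ {A} → r⇒ {A} ∘ r⇐ ≡ id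
      r-nat  : ∀ {A B} (f : Hom A B) → r⇒ ∘ (f ⊗₁ id {I}) ≡ f ∘ r⇒
      σ      : ∀ {A B} → Hom (A ⊗₀ B) (B ⊗₀ A)
      σ-nat  : ∀ {A B C D} (f : Hom A C) (g : Hom B D) → σ ∘ (f ⊗₁ g) ≡ (g ⊗₁ f) ∘ σ
      σ-inv  : ∀ {A B} → σ {B} {A} ∘ σ {A} {B} ≡ id
      triangle : ∀ {A B} → (id {A} ⊗₁ l⇒ {B}) ∘ a⇒ ≡ r⇒ ⊗₁ id
      pentagon : ∀ {A B C D} →
                 (id {A} ⊗₁ a⇒ {B} {C} {D}) ∘ a⇒ ∘ (a⇒ ⊗₁ id) ≡ a⇒ ∘ a⇒
      hexagon  : ∀ {A B C} →
                 a⇒ {B} {C} {A} ∘ σ ∘ a⇒ ≡ (id ⊗₁ σ) ∘ a⇒ ∘ (σ ⊗₁ id)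
      _⊸_    : Obj → Obj → Obj
      ev     : ∀ {A B} → Hom (A ⊗₀ (A ⊸ B)) B
      curry  : ∀ {A B Z} → Hom (A ⊗₀ Z) B → Hom Z (A ⊸ B)
      curry-β : ∀ {A B Z} (g : Hom (A ⊗₀ Z) B) → ev ∘ (id ⊗₁ curry g) ≡ g
      curry-unique : ∀ {A B Z} (g : Hom (A ⊗₀ Z) B) (k : Hom Z (A ⊸ B)) →
                     ev ∘ (id ⊗₁ k) ≡ g → k ≡ curry g

    _⊸₁_ : ∀ {A B} → Hom A B → (Z : Obj) → Hom (B ⊸ Z) (A ⊸ Z)
    f ⊸₁ Z = curry (ev ∘ (f ⊗₁ id))

module _ {o h} {C : Category o h} (M : SymMonClosed C) where
  open Category C
  open SymMonClosed M
  open CompleteLattice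

  record MonoidalSLattFunctor (ℓ : Level) : Set (o ⊔ h ⊔ lsuc ℓ) where
    field
      Q₀    : Obj → CompleteLattice ℓ
      Q₁    : ∀ {A B} → Hom A B → Carrier (Q₀ A) → Carrier (Q₀ B)
      Q-id  : ∀ {A} (x : Carrier (Q₀ A)) → Q₁ (id {A}) x ≡ x
      Q-∘   : ∀ {A B D} (f : Hom A B) (g : Hom B D) (x : Carrier (Q₀ A)) →
              Q₁ (g ∘ f) x ≡ Q₁ g (Q₁ f x)
      Q-mono : ∀ {A B} (f : Hom A B) {x y : Carrier (Q₀ A)} →
               _≤_ (Q₀ A) x y → _≤_ (Q₀ B) (Q₁ f x) (Q₁ f y)
      Q-sup : ∀ {A B} (f : Hom A B) (S : Pred (Carrier (Q₀ A)) ℓ) →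
              Q₁ f (⋁ (Q₀ A) S) ≡ ⋁ (Q₀ B) (Image (Q₁ f) S)
      u     : Carrier (Q₀ I)
      μ     : ∀ {A B} → Carrier (Q₀ A) → Carrier (Q₀ B) → Carrier (Q₀ (A ⊗₀ B))
      μ-mono : ∀ {A B} {x x' : Carrier (Q₀ A)} {y y' : Carrier (Q₀ B)} →
               _≤_ (Q₀ A) x x' → _≤_ (Q₀ B) y y' → _≤_ (Q₀ (A ⊗₀ B)) (μ x y) (μ x' y')
      μ-nat : ∀ {A B A' B'} (f : Hom A A') (g : Hom B B') x y →
              Q₁ (f ⊗₁ g) (μ x y) ≡ μ (Q₁ f x) (Q₁ g y)
      μ-supˡ : ∀ {A B} (S : Pred (Carrier (Q₀ A)) ℓ) (y : Carrier (Q₀ B)) →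
               μ (⋁ (Q₀ A) S) y ≡ ⋁ (Q₀ (A ⊗₀ B)) (Image (λ x → μ x y) S)
      μ-supʳ : ∀ {A B} (x : Carrier (Q₀ A)) (S : Pred (Carrier (Q₀ B)) ℓ) →
               μ x (⋁ (Q₀ B) S) ≡ ⋁ (Q₀ (A ⊗₀ B)) (Image (λ y → μ x y) S)
      μ-unitˡ : ∀ {B} (y : Carrier (Q₀ B)) → Q₁ l⇒ (μ u y) ≡ y
      μ-unitʳ : ∀ {A} (x : Carrier (Q₀ A)) → Q₁ r⇒ (μ x u) ≡ x
      μ-assoc : ∀ {A B D} (x : Carrier (Q₀ A)) (y : Carrier (Q₀ B)) (z : Carrier (Q₀ D)) →
                Q₁ a⇒ (μ (μ x y) z) ≡ μ x (μ y z)
      μ-sym   : ∀ {A B} (x : Carrier (Q₀ A)) (y : Carrier (Q₀ B)) →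
                Q₁ σ (μ x y) ≡ μ y x

  module _ {ℓ} (Q : MonoidalSLattFunctor ℓ) where
    open MonoidalSLattFunctor Q

    pairing : ∀ X Y → Carrier (Q₀ X) → Carrier (Q₀ (X ⊸ Y)) → Carrier (Q₀ Y)
    pairing X Y x b = Q₁ (ev {X} {Y}) (μ x b)

    ι : ∀ X Y → Carrier (Q₀ X) → Carrier (Q₀ Y) → Carrier (Q₀ (X ⊸ Y))
    ι X Y α β = ⋁ (Q₀ (X ⊸ Y)) (λ b → _≤_ (Q₀ Y) (pairing X Y α b) β)

    module _ (O : Obj) (ω : Carrier (Q₀ O)) where

      dual : Obj → Obj
      dual X = X ⊸ O

      ωmap : ∀ X → Carrier (Q₀ X) → Carrier (Q₀ (dual X))
      ωmap X α = ι X O α ω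

      -- The conclusion: ω_X : Q(X) → Q(X*)^op are SLatt-morphisms (sups in
      -- Q(X) go to sups in Q(X*)^op, i.e. infima in Q(X*)), natural in X
      -- with respect to f ↦ Q(f*)^op = right adjoint of Q(f*).
      OmegaIsSLattNatTrans : Set (o ⊔ h ⊔ lsuc ℓ)
      OmegaIsSLattNatTrans =
        (∀ X (S : Pred (Carrier (Q₀ X)) ℓ) →
           ωmap X (⋁ (Q₀ X) S) ≡ ⋀ (Q₀ (dual X)) (Image (ωmap X) S))
        × (∀ {X Y} (f : Hom X Y) (x : Carrier (Q₀ X)) →
           ωmap Y (Q₁ f x)
             ≡ rightAdjoint (Q₀ (dual Y)) (Q₀ (dual X)) (Q₁ (f ⊸₁ O)) (ωmap X x))

{-# OPTIONS --safe #-}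
-- ω_X(α) is the value at ω of the right adjoint of ⟨α , -⟩, and ⟨- , -⟩ preserves sups in
-- each variable; so ω_X turns sups into infima.  Naturality comes from dinaturality of
-- the pairing, ⟨Q f x , b⟩ = ⟨x , Q(f*) b⟩, together with (g ∘ k)ʳ = kʳ ∘ gʳ for
-- right adjoints.
module Submission where

open import Defs
open import Level using (Level) renaming (suc to lsuc)
open import Function using (_∘_)
open import Relation.Binary.PropositionalEquality
  using (_≡_; refl; sym; trans; cong; subst; module ≡-Reasoning)
open import Relation.Binary.Structures using (IsPartialOrder)
open import Relation.Unary using (Pred; _⊆_)
open import Data.Product using (_,_)

module CompleteLatticeProperties {ℓ} (L : CompleteLattice ℓ) where
  open CompleteLattice L hiding (Carrier)

  ≤-refl : ∀ {x} → x ≤ x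
  ≤-refl = IsPartialOrder.refl isPartialOrder

  ≤-trans : ∀ {x y z} → x ≤ y → y ≤ z → x ≤ z
  ≤-trans = IsPartialOrder.trans isPartialOrder

  ≤-antisym : ∀ {x y} → x ≤ y → y ≤ x → x ≡ y
  ≤-antisym = IsPartialOrder.antisym isPartialOrder

  ⋁-mono : ∀ {S T : Pred (Carrier L) ℓ} → S ⊆ T → ⋁ S ≤ ⋁ T
  ⋁-mono {S} {T} S⊆T = ⋁-least S (⋁ T) (λ x Sx → ⋁-upper T x (S⊆T Sx))

  ⋁-cong : ∀ {S T : Pred (Carrier L) ℓ} → S ⊆ T → T ⊆ S → ⋁ S ≡ ⋁ T
  ⋁-cong S⊆T T⊆S = ≤-antisym (⋁-mono S⊆T) (⋁-mono T⊆S)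

  ⋀-lower : ∀ (S : Pred (Carrier L) ℓ) x → S x → ⋀ S ≤ x
  ⋀-lower S x Sx = ⋁-least _ x (λ y y≤S → y≤S x Sx)

  ⋀-greatest : ∀ (S : Pred (Carrier L) ℓ) y → (∀ x → S x → y ≤ x) → y ≤ ⋀ S
  ⋀-greatest S y = ⋁-upper _ y

open CompleteLattice using (_≤_; ⋁; ⋀)
open CompleteLatticeProperties

module _ {ℓ} (L M : CompleteLattice ℓ) where

  Monotone : (Carrier L → Carrier M) → Set ℓ
  Monotone g = ∀ {x y} → _≤_ L x y → _≤_ M (g x) (g y)

  PreservesSups : (Carrier L → Carrier M) → Set (lsuc ℓ)
  PreservesSups g = ∀ S → g (⋁ L S) ≡ ⋁ M (Image g S)

  ⋁-Image-least : ∀ (g : Carrier L → Carrier M) S y →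
                  (∀ x → S x → _≤_ M (g x) y) → _≤_ M (⋁ M (Image g S)) y
  ⋁-Image-least g S y g[S]≤y =
    CompleteLattice.⋁-least M _ y λ { _ (x , Sx , refl) → g[S]≤y x Sx }

  ≤-rightAdjoint : ∀ (g : Carrier L → Carrier M) {l m} →
                   _≤_ M (g l) m → _≤_ L l (rightAdjoint L M g m)
  ≤-rightAdjoint g {l} = CompleteLattice.⋁-upper L _ l

  rightAdjoint-counit : ∀ {g : Carrier L → Carrier M} → Monotone g → PreservesSups g →
                        ∀ {l m} → _≤_ L l (rightAdjoint L M g m) → _≤_ M (g l) m
  rightAdjoint-counit {g} g-mono g-sup {m = m} l≤gʳm =
    ≤-trans M (g-mono l≤gʳm) (subst (λ z → _≤_ M z m) (sym (g-sup _))
      (⋁-Image-least g _ m (λ _ gx≤m → gx≤m)))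

  rightAdjoint-cong : ∀ {g g' : Carrier L → Carrier M} → (∀ l → g l ≡ g' l) →
                      ∀ m → rightAdjoint L M g m ≡ rightAdjoint L M g' m
  rightAdjoint-cong g≗g' m =
    ⋁-cong L (λ {l} → subst (λ z → _≤_ M z m) (g≗g' l))
             (λ {l} → subst (λ z → _≤_ M z m) (sym (g≗g' l)))

module _ {ℓ} (K L M : CompleteLattice ℓ) where

  preservesSups-∘ : ∀ {f : Carrier K → Carrier L} {g : Carrier L → Carrier M} →
                    PreservesSups K L f → PreservesSups L M g → PreservesSups K M (g ∘ f)
  preservesSups-∘ {f} {g} f-sup g-sup S = begin
    g (f (⋁ K S))                ≡⟨ cong g (f-sup S) ⟩
    g (⋁ L (Image f S))          ≡⟨ g-sup _ ⟩
    ⋁ M (Image g (Image f S))    ≡⟨ ⋁-cong M (λ { (_ , (x , Sx , refl) , refl) → x , Sx , refl })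
                                             (λ { (x , Sx , refl) → f x , (x , Sx , refl) , refl }) ⟩
    ⋁ M (Image (g ∘ f) S)        ∎
    where open ≡-Reasoning

  rightAdjoint-∘ : ∀ {g : Carrier L → Carrier M} → Monotone L M g → PreservesSups L M g →
                   ∀ (k : Carrier K → Carrier L) m →
                   rightAdjoint K M (g ∘ k) m ≡ rightAdjoint K L k (rightAdjoint L M g m)
  rightAdjoint-∘ {g} g-mono g-sup k m =
    ⋁-cong K (≤-rightAdjoint L M g) (rightAdjoint-counit L M g-mono g-sup)

module _ {ℓ} (A B C : CompleteLattice ℓ) (φ : Carrier A → Carrier B → Carrier C)
         (φ-monoˡ : ∀ b → Monotone A C (λ a → φ a b)) (φ-monoʳ : ∀ a → Monotone B C (φ a))
         (φ-supˡ : ∀ b → PreservesSups A C (λ a → φ a b)) (φ-supʳ : ∀ a → PreservesSups B C (φ a))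
         where

  rightAdjoint-⋁ˡ : ∀ S c → rightAdjoint B C (φ (⋁ A S)) c
                            ≡ ⋀ B (Image (λ a → rightAdjoint B C (φ a) c) S)
  rightAdjoint-⋁ˡ S c = ≤-antisym B
    (⋀-greatest B _ _ λ { _ (a , Sa , refl) →
      ≤-rightAdjoint B C (φ a)
        (≤-trans C (φ-monoˡ _ (CompleteLattice.⋁-upper A S a Sa))
                   (counit (⋁ A S) (≤-refl B))) })
    (≤-rightAdjoint B C _
      (subst (λ z → _≤_ C z c) (sym (φ-supˡ _ S))
        (⋁-Image-least A C _ S c λ a Sa → counit a (⋀-lower B _ _ (a , Sa , refl)))))
    where
    counit : ∀ a {b} → _≤_ B b (rightAdjoint B C (φ a) c) → _≤_ C (φ a b) c
    counit a = rightAdjoint-counit B C (φ-monoʳ a) (φ-supʳ a)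

module _ {o h ℓ : Level} {C : Category o h} (M : SymMonClosed C)
         (Q : MonoidalSLattFunctor M ℓ) where
  open Category C hiding (_∘_)
  open Category C using () renaming (_∘_ to _∘C_)
  open SymMonClosed M
  open MonoidalSLattFunctor Q

  μ-natˡ : ∀ {A A' B} (f : Hom A A') x (y : Carrier (Q₀ B)) →
           Q₁ (f ⊗₁ id) (μ x y) ≡ μ (Q₁ f x) y
  μ-natˡ f x y = trans (μ-nat f id x y) (cong (μ (Q₁ f x)) (Q-id y))

  μ-natʳ : ∀ {A B B'} (g : Hom B B') (x : Carrier (Q₀ A)) y →
           Q₁ (id ⊗₁ g) (μ x y) ≡ μ x (Q₁ g y)
  μ-natʳ g x y = trans (μ-nat id g x y) (cong (λ z → μ z (Q₁ g y)) (Q-id x))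

  pairing-monoˡ : ∀ {X Y} b → Monotone (Q₀ X) (Q₀ Y) (λ a → pairing M Q X Y a b)
  pairing-monoˡ {X} {Y} b a≤a' = Q-mono ev (μ-mono a≤a' (≤-refl (Q₀ (X ⊸ Y))))

  pairing-monoʳ : ∀ {X Y} a → Monotone (Q₀ (X ⊸ Y)) (Q₀ Y) (pairing M Q X Y a)
  pairing-monoʳ {X} a b≤b' = Q-mono ev (μ-mono (≤-refl (Q₀ X)) b≤b')

  pairing-supˡ : ∀ {X Y} b → PreservesSups (Q₀ X) (Q₀ Y) (λ a → pairing M Q X Y a b)
  pairing-supˡ {X} {Y} b =
    preservesSups-∘ (Q₀ X) (Q₀ (X ⊗₀ (X ⊸ Y))) (Q₀ Y) (λ S → μ-supˡ S b) (Q-sup ev)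

  pairing-supʳ : ∀ {X Y} a → PreservesSups (Q₀ (X ⊸ Y)) (Q₀ Y) (pairing M Q X Y a)
  pairing-supʳ {X} {Y} a =
    preservesSups-∘ (Q₀ (X ⊸ Y)) (Q₀ (X ⊗₀ (X ⊸ Y))) (Q₀ Y) (μ-supʳ a) (Q-sup ev)

  pairing-dinatural : ∀ {X Y} Z (f : Hom X Y) x b →
                      pairing M Q Y Z (Q₁ f x) b ≡ pairing M Q X Z x (Q₁ (f ⊸₁ Z) b)
  pairing-dinatural Z f x b = begin
    Q₁ ev (μ (Q₁ f x) b)                  ≡⟨ cong (Q₁ ev) (sym (μ-natˡ f x b)) ⟩
    Q₁ ev (Q₁ (f ⊗₁ id) (μ x b))          ≡⟨ sym (Q-∘ _ ev (μ x b)) ⟩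
    Q₁ (ev ∘C (f ⊗₁ id)) (μ x b)          ≡⟨ cong (λ g → Q₁ g (μ x b)) (sym (curry-β _)) ⟩
    Q₁ (ev ∘C (id ⊗₁ (f ⊸₁ Z))) (μ x b)   ≡⟨ Q-∘ _ ev (μ x b) ⟩
    Q₁ ev (Q₁ (id ⊗₁ (f ⊸₁ Z)) (μ x b))   ≡⟨ cong (Q₁ ev) (μ-natʳ (f ⊸₁ Z) x b) ⟩
    Q₁ ev (μ x (Q₁ (f ⊸₁ Z) b))           ∎
    where open ≡-Reasoning

mainTheorem5 : ∀ {o h ℓ : Level} {C : Category o h} (M : SymMonClosed C)
                 (Q : MonoidalSLattFunctor M ℓ)
                 (O : Category.Obj C)
                 (ω : Carrier (MonoidalSLattFunctor.Q₀ Q O)) →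
                 OmegaIsSLattNatTrans M Q O ω
mainTheorem5 {ℓ = ℓ} {C = C} M Q O ω = ω-⋁ , ω-natural
  where
  open Category C using (Hom)
  open SymMonClosed M using (_⊸_; _⊸₁_)
  open MonoidalSLattFunctor Q using (Q₀; Q₁)

  ω-⋁ : ∀ X (S : Pred (Carrier (Q₀ X)) ℓ) →
        ωmap M Q O ω X (⋁ (Q₀ X) S) ≡ ⋀ (Q₀ (X ⊸ O)) (Image (ωmap M Q O ω X) S)
  ω-⋁ X S = rightAdjoint-⋁ˡ (Q₀ X) (Q₀ (X ⊸ O)) (Q₀ O) (pairing M Q X O)
    (pairing-monoˡ M Q) (pairing-monoʳ M Q) (pairing-supˡ M Q) (pairing-supʳ M Q) S ω

  ω-natural : ∀ {X Y} (f : Hom X Y) x →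
              ωmap M Q O ω Y (Q₁ f x)
                ≡ rightAdjoint (Q₀ (Y ⊸ O)) (Q₀ (X ⊸ O)) (Q₁ (f ⊸₁ O)) (ωmap M Q O ω X x)
  ω-natural {X} {Y} f x = begin
    rightAdjoint (Q₀ (Y ⊸ O)) (Q₀ O) (pairing M Q Y O (Q₁ f x)) ω
      ≡⟨ rightAdjoint-cong (Q₀ (Y ⊸ O)) (Q₀ O) (pairing-dinatural M Q O f x) ω ⟩
    rightAdjoint (Q₀ (Y ⊸ O)) (Q₀ O) (pairing M Q X O x ∘ Q₁ (f ⊸₁ O)) ω
      ≡⟨ rightAdjoint-∘ (Q₀ (Y ⊸ O)) (Q₀ (X ⊸ O)) (Q₀ O)
           (pairing-monoʳ M Q x) (pairing-supʳ M Q x) (Q₁ (f ⊸₁ O)) ω ⟩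
    rightAdjoint (Q₀ (Y ⊸ O)) (Q₀ (X ⊸ O)) (Q₁ (f ⊸₁ O)) (ωmap M Q O ω X x)
      ∎
    where open ≡-Reasoning
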